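{- Let $a<b$ be integers and let $\mathcal{A}$ denote Algorithm $\mathcal{A}(a,b)$ (defined in the context). Let $\mathcal{S}$ be any input stream (not necessarily in random order) of closed unit-length intervals each fully contained in $[a,b)$, and let $\mathcal{S}'$ be any substream of $\mathcal{S}$ (a subsequence, keeping the relative order). Then $|OUT(\mathcal{A}(\mathcal{S}'))|\le|OUT(\mathcal{A}(\mathcal{S}))|$, where $OUT(\mathcal{A}(\mathcal{T}))$ denotes the output of the algorithm when run on the stream $\mathcal{T}$.
   Context: For closed intervals $I=[a_I,b_I]$, $J=[a_J,b_J]$: $I$ is further left than $J$ if $a_I<a_J$; $I$ is further right than $J$ if $b_I>b_J$; $I,J$ are independent if $I\cap J=\varnothing$. Algorithm $\mathcal{A}(a,b)$, for integers $a<b$, processes a stream of closed unit-length intervals each contained in $[a,b)$. At initialisation, for each integer $i\in\{a+1,\dots,b-1\}$ it sets variables $L_i\gets\emptyset$, $R_i\gets\emptyset$ and creates four new recursive instances: $\mathcal{T}^L_i$ and $\mathcal{A}^L_i$ of $\mathcal{A}(a,i)$, and $\mathcal{T}^R_i$ and $\mathcal{A}^R_i$ of $\mathcal{A}(i,b)$. When an interval $I$ arrives, for each $i\in\{a+1,\dots,b-1\}$: (R) if $I\subseteq[i,b)$: feed $I$ into $\mathcal{T}^R_i$; if $R_i=\emptyset$ or $I$ is further left than $R_i$, set $R_i\gets I$; then if $R_i\neq\emptyset$, $I$ is independent of $R_i$ and $I$ is further right than $R_i$, feed $I$ into $\mathcal{A}^R_i$. (L) if $I\subseteq[a,i)$: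 feed $I$ into $\mathcal{T}^L_i$; if $L_i=\emptyset$ or $I$ is further right than $L_i$, set $L_i\gets I$; then if $L_i\neq\emptyset$, $I$ is independent of $L_i$ and $I$ is further left than $L_i$, feed $I$ into $\mathcal{A}^L_i$. At the end of the stream, the output $OUT(\mathcal{A})$ is a largest set among the sets $OUT(\mathcal{T}^L_i)\cup R_i\cup OUT(\mathcal{A}^R_i)$ and $OUT(\mathcal{A}^L_i)\cup L_i\cup OUT(\mathcal{T}^R_i)$ for $i\in\{a+1,\dots,b-1\}$ (an empty variable contributes nothing; if there are no such $i$, the output is empty).
   Formalization: The unit-length intervals in the streams have rational endpoints rather than real ones. -}

module Defs where

open import Data.Bool using (Bool; true; false; _∧_; _∨_; if_then_else_)
open import Data.Nat as ℕ using (ℕ; zero; suc; _∸_)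
open import Data.Integer as ℤ using (ℤ; +_; ∣_∣)
open import Data.Rational using (ℚ; _/_; 1ℚ; _+_; _≤_; _<_)
open import Data.Rational.Properties using (_≤?_; _<?_)
open import Data.Maybe using (Maybe; just; nothing)
open import Data.List using (List; []; _∷_; _++_; filter; length; upTo; concatMap)
open import Data.Product using (_×_; _,_)
open import Relation.Nullary using (does; Dec)
open import Relation.Unary using (Pred; Decidable)
open import Relation.Nullary.Decidable using (_×-dec_)
open import Level using (0ℓ)

-- A closed unit-length interval I = [s, s+1] is represented by its left
-- endpoint s : ℚ  (a_I = s, b_I = s + 1).
Interval : Set
Interval = ℚ

ι : ℤ → ℚ
ι z = z / 1

ContainedIn : ℤ → ℤ → Pred Interval 0ℓ
ContainedIn lo hi s = (ι lo ≤ s) × (s + 1ℚ < ι hi)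

containedIn? : (lo hi : ℤ) → Decidable (ContainedIn lo hi)
containedIn? lo hi s = (ι lo ≤? s) ×-dec ((s + 1ℚ) <? ι hi)

furtherLeft : Interval → Interval → Bool
furtherLeft s t = does (s <? t)

-- I further right than J : b_I > b_J
furtherRight : Interval → Interval → Bool
furtherRight s t = does ((t + 1ℚ) <? (s + 1ℚ))

-- closed intervals I, J disjoint : b_I < a_J or b_J < a_I
independent : Interval → Interval → Bool
independent s t = does ((s + 1ℚ) <? t) ∨ does ((t + 1ℚ) <? s)

maybeToList : Maybe Interval → List Interval
maybeToList nothing  = []
maybeToList (just x) = x ∷ []

updR : Maybe Interval → Interval → Maybe Interval
updR nothing  I = just I
updR (just r) I = if furtherLeft I r then just I else just r

updL : Maybe Interval → Interval → Maybe Interval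
updL nothing  I = just I
updL (just l) I = if furtherRight I l then just I else just l

-- feeding condition into A^R_i (evaluated with the updated R_i)
feedR : Maybe Interval → Interval → Bool
feedR nothing  I = false
feedR (just r) I = independent I r ∧ furtherRight I r

-- feeding condition into A^L_i (evaluated with the updated L_i)
feedL : Maybe Interval → Interval → Bool
feedL nothing  I = false
feedL (just l) I = independent I l ∧ furtherLeft I l

-- Processing the whole stream for the (R) part at index i of A(a,b):
-- given the current R_i, returns the final R_i and the substream fed into A^R_i
-- (in stream order).
procR : (i b : ℤ) → Maybe Interval → List Interval → Maybe Interval × List Interval
procR i b R [] = R , []
procR i b R (I ∷ S) with does (containedIn? i b I)
... | false = procR i b R S
... | true with procR i b (updR R I) S
...   | Rf , fed = Rf , (if feedR (updR R I) I then I ∷ fed else fed)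

procL : (a i : ℤ) → Maybe Interval → List Interval → Maybe Interval × List Interval
procL a i L [] = L , []
procL a i L (I ∷ S) with does (containedIn? a i I)
... | false = procL a i L S
... | true with procL a i (updL L I) S
...   | Lf , fed = Lf , (if feedL (updL L I) I then I ∷ fed else fed)

restrict : (lo hi : ℤ) → List Interval → List Interval
restrict lo hi = filter (containedIn? lo hi)

largest : List (List Interval) → List Interval
largest []       = []
largest (X ∷ Xs) with largest Xs
... | Y = if does (length Y ℕ.≤? length X) then X else Y

-- run fuel a n S  :  output of A(a, a+n) on stream S.
-- The fuel only serves termination checking; with fuel ≥ n (as used by OUT)
-- every recursive call has enough fuel (subinstances have width < n).
run : ℕ → ℤ → ℕ → List Interval → List Interval
run zero     a n S = []
run (suc f) a n S = largest (concatMap cands (Data.List.map suc (upTo (n ∸ 1))))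
  where
  b : ℤ
  b = a ℤ.+ + n
  -- candidates for index i = a + k, k ∈ {1, …, n-1}
  cands : ℕ → List (List Interval)
  cands k with procR (a ℤ.+ + k) b nothing S | procL a (a ℤ.+ + k) nothing S
  ... | R , fedAR | L , fedAL =
      (run f a k (restrict a i S) ++ maybeToList R ++ run f i (n ∸ k) fedAR)
    ∷ (run f a k fedAL ++ maybeToList L ++ run f i (n ∸ k) (restrict i b S))
    ∷ []
    where
    i : ℤ
    i = a ℤ.+ + k

OUT : ℤ → ℤ → List Interval → List Interval
OUT a b S = run w a w S
  where
  w : ℕ
  w = ∣ b ℤ.- a ∣

{-# OPTIONS --safe #-}
module Submission where

-- While the stream is read, R_i is the leftmost interval of [i, b) seen so far.  On S it
-- is therefore at every moment at least as far left as on the substream S′ (and nonempty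
-- whenever it is on S′).  For unit intervals the test "I is independent of R_i and further
-- right" says b_{R_i} < a_I, which is thus weaker on S, so the stream fed into A^R_i from
-- S′ is a substream of the one fed from S.  Symmetrically for L_i, and the inputs of
-- T^L_i, T^R_i are plain restrictions.  Hence every candidate output for S′ is no longer
-- than the corresponding one for S, and so is the largest.

open import Defs
open import Data.Bool using (Bool; true; false; T; if_then_else_)
open import Data.Empty using (⊥-elim)
open import Data.Integer as ℤ using (ℤ; +_; ∣_∣)
import Data.Integer
open import Data.List using (List; []; _∷_; _++_; length; map; upTo)
open import Data.List.Properties using (length-++)
open import Data.List.Relation.Binary.Pointwise using (Pointwise; []; _∷_; concat⁺; map⁺)
import Data.List.Relation.Binary.Pointwise.Properties as Pointwise
open import Data.List.Relation.Binary.Sublist.Propositional using (_⊆_; []; _∷_; _∷ʳ_)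
open import Data.List.Relation.Binary.Sublist.Propositional.Properties using (filter⁺)
open import Data.List.Relation.Unary.All using (All)
open import Data.Maybe using (just; nothing)
open import Data.Nat using (ℕ; zero; suc; _≤_; z≤n; _⊔_; _∸_)
import Data.Nat.Properties as ℕ
open import Data.Product using (_×_; _,_; proj₁; proj₂; map₂)
open import Data.Rational as ℚ using (ℚ; 1ℚ; _+_; _<_; _⊓_)
open import Data.Rational.Properties
  using (_<?_; <-trans; <-asym; <-irrefl; <⇒≤; ≮⇒≥; ≤-<-trans; <-≤-trans; +-monoʳ-<; +-monoˡ-<;
         +-monoˡ-≤; +-identityʳ; positive⁻¹; p≤q⇒p⊓q≡p; p≥q⇒p⊓q≡q; p≤q⇒p⊔q≡q; p≥q⇒p⊔q≡p;
         p⊓q≤p; p⊓q≤q; p≤p⊔q; p≤q⊔p; ⊓-monoʳ-≤; ⊔-monoʳ-≤)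
  renaming (≤-refl to ℚ-≤-refl; ≤-trans to ℚ-≤-trans)
open import Data.Sum using (_⊎_; inj₁; inj₂)
open import Function using (_∘_)
open import Function.Bundles using (_⇔_; mk⇔; module Equivalence)
import Function.Properties.Equivalence as ⇔
open import Level using (0ℓ)
open import Relation.Binary using (Rel; Transitive)
open import Relation.Binary.PropositionalEquality using (_≡_; refl; sym; cong; subst; subst₂)
import Relation.Binary.Construct.Add.Supremum.NonStrict as Supremum
open import Relation.Nullary using (Dec; does; yes; no; contradiction)
open import Relation.Nullary.Decidable using (_×-dec_; _⊎-dec_)

T-does : ∀ {A : Set} (a? : Dec A) → T (does a?) ⇔ A
T-does (yes a) = mk⇔ (λ _ → a) _
T-does (no ¬a) = mk⇔ (λ ()) ¬a

consIf : {A : Set} → Bool → A → List A → List A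
consIf b x xs = if b then x ∷ xs else xs

consIf-⊆ : ∀ {A : Set} {b b′ : Bool} {x : A} {xs ys} → (T b′ → T b) → xs ⊆ ys → consIf b′ x xs ⊆ consIf b x ys
consIf-⊆ {b = true}  {true}  _    xs⊆ys = refl ∷ xs⊆ys
consIf-⊆ {b = true}  {false} _    xs⊆ys = _ ∷ʳ xs⊆ys
consIf-⊆ {b = false} {false} _    xs⊆ys = xs⊆ys
consIf-⊆ {b = false} {true}  b′⇒b _     = ⊥-elim (b′⇒b _)

module Scan {A St : Set} (keep : A → Bool) (step : St → A → St) (feed : St → A → Bool) where

  scan : St → List A → St × List A
  scan s []       = s , []
  scan s (x ∷ xs) with keep x
  ... | false = scan s xs
  ... | true  = map₂ (consIf (feed (step s x) x) x) (scan (step s x) xs)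

  module _ {_⊑_ : Rel St 0ℓ} (⊑-trans : Transitive _⊑_)
           (step-mono : ∀ x {s s′} → s ⊑ s′ → step s x ⊑ step s′ x)
           (step-deflationary : ∀ s x → step s x ⊑ s)
           (feed-antitone : ∀ x {s s′} → s ⊑ s′ → T (feed s′ x) → T (feed s x)) where

    scan-mono : ∀ {s s′ xs ys} → s ⊑ s′ → ys ⊆ xs →
                proj₁ (scan s xs) ⊑ proj₁ (scan s′ ys) × proj₂ (scan s′ ys) ⊆ proj₂ (scan s xs)
    scan-mono s⊑s′ [] = s⊑s′ , []
    scan-mono {s} s⊑s′ (x ∷ʳ ys⊆xs) with keep x
    ... | false = scan-mono s⊑s′ ys⊆xs
    ... | true  = map₂ (consIf-⊆ (λ ())) (scan-mono (⊑-trans (step-deflationary s x) s⊑s′) ys⊆xs)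
    scan-mono {xs = x ∷ _} s⊑s′ (refl ∷ ys⊆xs) with keep x
    ... | false = scan-mono s⊑s′ ys⊆xs
    ... | true  = map₂ (consIf-⊆ (feed-antitone x (step-mono x s⊑s′))) (scan-mono (step-mono x s⊑s′) ys⊆xs)

-- A record rather than `_≤_ on length`, so that unification can recover both lists.
infix 4 _≲_
record _≲_ {A : Set} (xs ys : List A) : Set where
  constructor mk≲
  field length-≤ : length xs ≤ length ys
open _≲_

++-mono-≲ : ∀ {A : Set} {xs xs′ ys ys′ : List A} → xs ≲ xs′ → ys ≲ ys′ → xs ++ ys ≲ xs′ ++ ys′
++-mono-≲ {xs = xs} {xs′} (mk≲ xs≤xs′) (mk≲ ys≤ys′) =
  mk≲ (subst₂ _≤_ (sym (length-++ xs)) (sym (length-++ xs′)) (ℕ.+-mono-≤ xs≤xs′ ys≤ys′))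

length-largest-∷ : ∀ X Xs → length (largest (X ∷ Xs)) ≡ length X ⊔ length (largest Xs)
length-largest-∷ X Xs = by-cases (length (largest Xs) ℕ.≤? length X)
  where
  by-cases : (d : Dec (length (largest Xs) ≤ length X)) →
             length (if does d then X else largest Xs) ≡ length X ⊔ length (largest Xs)
  by-cases (yes Y≤X) = sym (ℕ.m≥n⇒m⊔n≡m Y≤X)
  by-cases (no Y≰X)  = sym (ℕ.m≤n⇒m⊔n≡n (ℕ.<⇒≤ (ℕ.≰⇒> Y≰X)))

largest-mono : ∀ {Xs Ys} → Pointwise _≲_ Xs Ys → largest Xs ≲ largest Ys
largest-mono []                                = mk≲ z≤n
largest-mono {X ∷ Xs} {Y ∷ Ys} (X≲Y ∷ Xs≲Ys) = mk≲ (begin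
  length (largest (X ∷ Xs))       ≡⟨ length-largest-∷ X Xs ⟩
  length X ⊔ length (largest Xs)  ≤⟨ ℕ.⊔-mono-≤ (length-≤ X≲Y) (length-≤ (largest-mono Xs≲Ys)) ⟩
  length Y ⊔ length (largest Ys)  ≡⟨ length-largest-∷ Y Ys ⟨
  length (largest (Y ∷ Ys))       ∎)
  where open ℕ.≤-Reasoning

module _ {_≼_ : Rel ℚ 0ℓ} where
  open Supremum _≼_

  maybeToList-antitone : ∀ {m m′} → m ≤⁺ m′ → maybeToList m′ ≲ maybeToList m
  maybeToList-antitone [ _ ]   = mk≲ ℕ.≤-refl
  maybeToList-antitone (_ ≤⊤⁺) = mk≲ z≤n

p<p+1 : ∀ p → p < p + 1ℚ
p<p+1 p = subst (_< p + 1ℚ) (+-identityʳ p) (+-monoʳ-< p (positive⁻¹ 1ℚ))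

T-feedR-just : ∀ r x → T (feedR (just r) x) ⇔ r + 1ℚ < x
T-feedR-just r x = ⇔.trans (T-does feed?) (mk⇔ to from)
  where
  feed? : Dec ((x + 1ℚ < r ⊎ r + 1ℚ < x) × r + 1ℚ < x + 1ℚ)
  feed? = (x + 1ℚ <? r ⊎-dec r + 1ℚ <? x) ×-dec (r + 1ℚ <? x + 1ℚ)
  to : (x + 1ℚ < r ⊎ r + 1ℚ < x) × r + 1ℚ < x + 1ℚ → r + 1ℚ < x
  to (inj₂ r+1<x , _)       = r+1<x
  to (inj₁ x+1<r , r+1<x+1) = contradiction (<-trans x+1<r (<-trans (p<p+1 r) r+1<x+1)) (<-irrefl refl)
  from : r + 1ℚ < x → (x + 1ℚ < r ⊎ r + 1ℚ < x) × r + 1ℚ < x + 1ℚ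
  from r+1<x = inj₂ r+1<x , <-trans r+1<x (p<p+1 x)

T-feedL-just : ∀ l x → T (feedL (just l) x) ⇔ x + 1ℚ < l
T-feedL-just l x = ⇔.trans (T-does feed?) (mk⇔ to from)
  where
  feed? : Dec ((x + 1ℚ < l ⊎ l + 1ℚ < x) × x < l)
  feed? = (x + 1ℚ <? l ⊎-dec l + 1ℚ <? x) ×-dec (x <? l)
  to : (x + 1ℚ < l ⊎ l + 1ℚ < x) × x < l → x + 1ℚ < l
  to (inj₁ x+1<l , _)   = x+1<l
  to (inj₂ l+1<x , x<l) = contradiction (<-trans (p<p+1 l) (<-trans l+1<x x<l)) (<-irrefl refl)
  from : x + 1ℚ < l → (x + 1ℚ < l ⊎ l + 1ℚ < x) × x < l
  from x+1<l = inj₁ x+1<l , <-trans (p<p+1 x) x+1<l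

-- The test is analysed through a helper: after unfolding updR it is no longer
-- syntactically `x <? r`, so `with x <? r` would not abstract it.
updR-just : ∀ r x → updR (just r) x ≡ just (x ⊓ r)
updR-just r x = by-cases (x <? r)
  where
  by-cases : (x<r? : Dec (x < r)) → (if does x<r? then just x else just r) ≡ just (x ⊓ r)
  by-cases (yes x<r) = cong just (sym (p≤q⇒p⊓q≡p (<⇒≤ x<r)))
  by-cases (no x≮r)  = cong just (sym (p≥q⇒p⊓q≡q (≮⇒≥ x≮r)))

updL-just : ∀ l x → updL (just l) x ≡ just (x ℚ.⊔ l)
updL-just l x = by-cases (l + 1ℚ <? x + 1ℚ)
  where
  by-cases : (l+1<x+1? : Dec (l + 1ℚ < x + 1ℚ)) → (if does l+1<x+1? then just x else just l) ≡ just (x ℚ.⊔ l)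
  by-cases (yes l+1<x+1) = cong just (sym (p≥q⇒p⊔q≡p (≮⇒≥ {x} {l} λ x<l → <-asym l+1<x+1 (+-monoˡ-< 1ℚ x<l))))
  by-cases (no l+1≮x+1)  = cong just (sym (p≤q⇒p⊔q≡q (≮⇒≥ {l} {x} λ l<x → l+1≮x+1 (+-monoˡ-< 1ℚ l<x))))

-- An empty R_i or L_i is the top element; the order on R_i is ≤ (further left), on L_i it is ≥.
open Supremum ℚ._≤_ using (_≤⁺_; [_]; _≤⊤⁺; ≤⁺-trans)
open Supremum ℚ._≥_ using () renaming (_≤⁺_ to _≥⁺_; [_] to ≥[_]; _≤⊤⁺ to _≥⊤⁺; ≤⁺-trans to ≥⁺-trans)

updR-≤⁺-just : ∀ R x → updR R x ≤⁺ just x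
updR-≤⁺-just nothing  x = [ ℚ-≤-refl ]
updR-≤⁺-just (just r) x rewrite updR-just r x = [ p⊓q≤p x r ]

updR-deflationary : ∀ R x → updR R x ≤⁺ R
updR-deflationary nothing  x = _ ≤⊤⁺
updR-deflationary (just r) x rewrite updR-just r x = [ p⊓q≤q x r ]

updR-mono : ∀ x {R R′} → R ≤⁺ R′ → updR R x ≤⁺ updR R′ x
updR-mono x {R} (_ ≤⊤⁺) = updR-≤⁺-just R x
updR-mono x {just r} {just r′} [ r≤r′ ] rewrite updR-just r x | updR-just r′ x = [ ⊓-monoʳ-≤ x r≤r′ ]

feedR-antitone : ∀ x {R R′} → R ≤⁺ R′ → T (feedR R′ x) → T (feedR R x)
feedR-antitone x (_ ≤⊤⁺) ()
feedR-antitone x {just r} {just r′} [ r≤r′ ] fed =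
  Equivalence.from (T-feedR-just r x) (≤-<-trans (+-monoˡ-≤ 1ℚ r≤r′) (Equivalence.to (T-feedR-just r′ x) fed))

updL-≥⁺-just : ∀ L x → updL L x ≥⁺ just x
updL-≥⁺-just nothing  x = ≥[ ℚ-≤-refl ]
updL-≥⁺-just (just l) x rewrite updL-just l x = ≥[ p≤p⊔q x l ]

updL-deflationary : ∀ L x → updL L x ≥⁺ L
updL-deflationary nothing  x = _ ≥⊤⁺
updL-deflationary (just l) x rewrite updL-just l x = ≥[ p≤q⊔p x l ]

updL-mono : ∀ x {L L′} → L ≥⁺ L′ → updL L x ≥⁺ updL L′ x
updL-mono x {L} (_ ≥⊤⁺) = updL-≥⁺-just L x
updL-mono x {just l} {just l′} ≥[ l′≤l ] rewrite updL-just l x | updL-just l′ x = ≥[ ⊔-monoʳ-≤ x l′≤l ]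

feedL-antitone : ∀ x {L L′} → L ≥⁺ L′ → T (feedL L′ x) → T (feedL L x)
feedL-antitone x (_ ≥⊤⁺) ()
feedL-antitone x {just l} {just l′} ≥[ l′≤l ] fed =
  Equivalence.from (T-feedL-just l x) (<-≤-trans (Equivalence.to (T-feedL-just l′ x) fed) l′≤l)

procR≡scan : ∀ i b R S → procR i b R S ≡ Scan.scan (does ∘ containedIn? i b) updR feedR R S
procR≡scan i b R []      = refl
procR≡scan i b R (I ∷ S) with does (containedIn? i b I)
... | false = procR≡scan i b R S
... | true  = cong (map₂ (consIf (feedR (updR R I) I) I)) (procR≡scan i b (updR R I) S)

procL≡scan : ∀ a i L S → procL a i L S ≡ Scan.scan (does ∘ containedIn? a i) updL feedL L S
procL≡scan a i L []      = refl
procL≡scan a i L (I ∷ S) with does (containedIn? a i I)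
... | false = procL≡scan a i L S
... | true  = cong (map₂ (consIf (feedL (updL L I) I) I)) (procL≡scan a i (updL L I) S)

procR-mono : ∀ i b {R R′ S S′} → R ≤⁺ R′ → S′ ⊆ S →
             proj₁ (procR i b R S) ≤⁺ proj₁ (procR i b R′ S′) × proj₂ (procR i b R′ S′) ⊆ proj₂ (procR i b R S)
procR-mono i b {R} {R′} {S} {S′} rewrite procR≡scan i b R S | procR≡scan i b R′ S′ =
  scan-mono (≤⁺-trans ℚ-≤-trans) updR-mono updR-deflationary feedR-antitone
  where open Scan (does ∘ containedIn? i b) updR feedR

procL-mono : ∀ a i {L L′ S S′} → L ≥⁺ L′ → S′ ⊆ S →
             proj₁ (procL a i L S) ≥⁺ proj₁ (procL a i L′ S′) × proj₂ (procL a i L′ S′) ⊆ proj₂ (procL a i L S)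
procL-mono a i {L} {L′} {S} {S′} rewrite procL≡scan a i L S | procL≡scan a i L′ S′ =
  scan-mono (≥⁺-trans (λ p q → ℚ-≤-trans q p)) updL-mono updL-deflationary feedL-antitone
  where open Scan (does ∘ containedIn? a i) updL feedL

restrict-mono : ∀ lo hi {S S′} → S′ ⊆ S → restrict lo hi S′ ⊆ restrict lo hi S
restrict-mono lo hi = filter⁺ (containedIn? lo hi) (containedIn? lo hi) (subst (ContainedIn lo hi))

run-mono : ∀ fuel a n {S S′} → S′ ⊆ S → run fuel a n S′ ≲ run fuel a n S
run-mono zero       a n S′⊆S = mk≲ z≤n
run-mono (suc fuel) a n {S} {S′} S′⊆S =
  largest-mono (concat⁺ (map⁺ _ _ (Pointwise.refl (λ {k} →
    let i      = a ℤ.+ + k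
        R-mono = procR-mono i b (nothing ≤⊤⁺) S′⊆S
        L-mono = procL-mono a i (nothing ≥⊤⁺) S′⊆S
    in  ++-mono-≲ (run-mono fuel a k (restrict-mono a i S′⊆S))
          (++-mono-≲ (maybeToList-antitone (proj₁ R-mono)) (run-mono fuel i (n ∸ k) (proj₂ R-mono)))
      ∷ ++-mono-≲ (run-mono fuel a k (proj₂ L-mono))
          (++-mono-≲ (maybeToList-antitone (proj₁ L-mono)) (run-mono fuel i (n ∸ k) (restrict-mono i b S′⊆S)))
      ∷ []) {indices})))
  where
  b : ℤ
  b = a ℤ.+ + n
  indices : List ℕ
  indices = map suc (upTo (n ∸ 1))

lemma1 : (a b : ℤ) → a Data.Integer.< b → (S S′ : List Interval) → All (ContainedIn a b) S → S′ ⊆ S → length (OUT a b S′) ≤ length (OUT a b S)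
lemma1 a b _ S S′ _ S′⊆S = length-≤ (run-mono (∣ b ℤ.- a ∣) a (∣ b ℤ.- a ∣) S′⊆S)
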